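{- For every finite graph $G$, letting $k=\omega(G)+1$, we have $\chi_f(G)\le Z_f(G)+R(k,k)$.
   Context: $\omega(G)$ is the maximum size of a clique in $G$, and $R(k,k)$ is the diagonal Ramsey number (the least $N$ such that every graph on $N$ vertices contains a clique or an independent set of size $k$). A fractional coloring of $G$ is an assignment of nonnegative real weights to the independent sets of $G$ such that for every vertex $v$ the total weight of the independent sets containing $v$ is at least $1$; $\chi_f(G)$ is the minimum total weight of a fractional coloring. A fractional cocoloring is defined the same way but weights are assigned to cliques and independent sets, each vertex being covered by total weight at least $1$; $Z_f(G)$ is the minimum total weight of a fractional cocoloring.
   Formalization: The weights of fractional colorings and fractional cocolorings are rational instead of real, so χ_f(G) and Z_f(G) are taken as minima over rational weightings. -}

module Defs where

open import Data.Nat using (ℕ; _<_)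
open import Data.Integer using (+_)
open import Data.Fin using (Fin)
open import Data.Fin.Subset using (Subset; _∈_; ∣_∣; inside; outside)
open import Data.Vec using (lookup)
open import Data.List using (List; []; _∷_)
open import Data.List.Relation.Unary.All using (All)
open import Data.Product using (Σ; _×_; _,_; proj₁; proj₂)
open import Data.Sum using (_⊎_)
open import Data.Rational using (ℚ; _+_; _≤_; 0ℚ; 1ℚ; _/_)
open import Relation.Binary.PropositionalEquality using (_≡_; _≢_)
open import Relation.Nullary using (¬_)

record Graph (n : ℕ) : Set₁ where
  field
    Adj   : Fin n → Fin n → Set
    sym   : ∀ {u v} → Adj u v → Adj v u
    irrefl : ∀ {u} → ¬ Adj u u
open Graph public

module _ {n : ℕ} (G : Graph n) where

  IsIndependent : Subset n → Set
  IsIndependent S = ∀ u v → u ∈ S → v ∈ S → ¬ Adj G u v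

  IsClique : Subset n → Set
  IsClique S = ∀ u v → u ∈ S → v ∈ S → u ≢ v → Adj G u v

  IsCliqueNumber : ℕ → Set
  IsCliqueNumber w =
    Σ (Subset n) (λ S → IsClique S × ∣ S ∣ ≡ w) ×
    (∀ S → IsClique S → ∣ S ∣ Data.Nat.≤ w)

  WeightedFamily : Set
  WeightedFamily = List (Subset n × ℚ)

  totalWeight : WeightedFamily → ℚ
  totalWeight [] = 0ℚ
  totalWeight ((_ , q) ∷ F) = q + totalWeight F

  weightAt : Fin n → WeightedFamily → ℚ
  weightAt v [] = 0ℚ
  weightAt v ((S , q) ∷ F) with lookup S v
  ... | inside  = q + weightAt v F
  ... | outside = weightAt v F

  Covers : WeightedFamily → Set
  Covers F = ∀ v → 1ℚ ≤ weightAt v F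

  NonNeg : WeightedFamily → Set
  NonNeg F = All (λ p → 0ℚ ≤ proj₂ p) F

  IsFractionalColoring : WeightedFamily → Set
  IsFractionalColoring F =
    All (λ p → IsIndependent (proj₁ p)) F × NonNeg F × Covers F

  IsFractionalCocoloring : WeightedFamily → Set
  IsFractionalCocoloring F =
    All (λ p → IsClique (proj₁ p) ⊎ IsIndependent (proj₁ p)) F × NonNeg F × Covers F

  IsFracChromaticNumber : ℚ → Set
  IsFracChromaticNumber x =
    Σ WeightedFamily (λ F → IsFractionalColoring F × totalWeight F ≡ x) ×
    (∀ F → IsFractionalColoring F → x ≤ totalWeight F)

  IsFracCochromaticNumber : ℚ → Set
  IsFracCochromaticNumber z =
    Σ WeightedFamily (λ F → IsFractionalCocoloring F × totalWeight F ≡ z) ×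
    (∀ F → IsFractionalCocoloring F → z ≤ totalWeight F)

RamseyProperty : ℕ → ℕ → Set₁
RamseyProperty k N = (H : Graph N) →
  Σ (Subset N) (λ S → (IsClique H S ⊎ IsIndependent H S) × ∣ S ∣ ≡ k)

IsDiagRamseyNumber : ℕ → ℕ → Set₁
IsDiagRamseyNumber k N = RamseyProperty k N × (∀ M → M < N → ¬ RamseyProperty k M)

ℕtoℚ : ℕ → ℚ
ℕtoℚ N = + N / 1

module Submission where

-- Take an optimal fractional cocoloring F and split it into its clique part
-- Fc and its independent part Fi.  The independent part already is a
-- fractional coloring except that a vertex v may be covered only partly; its
-- deficit is at most the demand d v = min(1, weight of Fc at v).  Since every
-- clique has at most w vertices, double counting gives Σ d ≤ w·|Fc|.
--
-- The demand d is then covered by independent sets greedily: while the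
-- support of d has at least R vertices, Ramsey's property together with the
-- clique bound yields an independent set T of size K inside the support;
-- lowering d on T by its minimum ε over T costs weight ε, reduces Σ d by ε·K
-- and shrinks the support.  A support of fewer than R vertices is covered by
-- singletons at cost Σ d ≤ R.  Altogether K·|H| ≤ Σ d + K·R ≤ K·(|Fc| + R),
-- so H ++ Fi is a fractional coloring of weight ≤ |Fc| + |Fi| + R = Z_f + R.

open import Defs
open import Data.Nat using (ℕ; suc)
open import Data.Rational using (ℚ; _+_; _≤_)

open import Data.Nat as ℕ using (zero; z≤n; s≤s)
import Data.Nat.Properties as ℕP
open import Data.Nat.Induction using (<-wellFounded)
open import Induction.WellFounded using (Acc; acc)
import Data.Integer as ℤ
import Data.Integer.Properties as ℤP
import Data.Nat.Coprimality as Coprimality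
open import Data.Rational using (0ℚ; 1ℚ; _<_; _-_; -_; _*_; _⊓_; mkℚ; _/_; positive; nonNegative)
import Data.Rational.Properties as ℚP
open ℚP.≤-Reasoning
open import Data.Rational.Solver using (module +-*-Solver)
open +-*-Solver
open import Data.Fin using (Fin; zero; suc)
open import Data.Fin.Subset using (Subset; Side; inside; outside; _∈_; _⊆_; ∣_∣; ⁅_⁆; Nonempty; Empty)
open import Data.Fin.Subset.Properties using (p⊂q⇒∣p∣<∣q∣; x∈⁅x⁆; x∈⁅y⁆⇒x≡y)
open import Data.Vec using ([]; _∷_; lookup; here; there)
import Data.Vec as Vec
import Data.Vec.Properties as VecP
open import Data.List using ([]; _∷_; _++_; tabulate)
open import Data.List.Relation.Unary.All as All using (All; []; _∷_)
open import Data.List.Relation.Unary.All.Properties using (++⁺; tabulate⁺)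
open import Data.Product using (Σ; ∃; _×_; _,_; proj₁; proj₂)
open import Data.Sum using (_⊎_; inj₁; inj₂)
open import Data.Empty using (⊥; ⊥-elim)
open import Function using (_∘_)
open import Relation.Nullary using (yes; no)
open import Relation.Binary.PropositionalEquality as ≡ using (_≡_; refl; trans; cong)

ℕtoℚ-normal : ∀ n → ℕtoℚ n ≡ mkℚ (ℤ.+ n) 0 (Coprimality.sym (Coprimality.1-coprimeTo n))
ℕtoℚ-normal n = ℚP.normalize-coprime (Coprimality.sym (Coprimality.1-coprimeTo n))

ℕtoℚ-suc : ∀ n → ℕtoℚ (suc n) ≡ 1ℚ + ℕtoℚ n
ℕtoℚ-suc n rewrite ℕtoℚ-normal n =
  cong (λ i → i / 1) (cong (ℤ._+_ (ℤ.+ 1)) (≡.sym (ℤP.*-identityʳ (ℤ.+ n))))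

0≤1 : 0ℚ ≤ 1ℚ
0≤1 = ℚP.<⇒≤ (ℚP.positive⁻¹ 1ℚ)

ℕtoℚ-nonNeg : ∀ n → 0ℚ ≤ ℕtoℚ n
ℕtoℚ-nonNeg zero = ℚP.≤-refl
ℕtoℚ-nonNeg (suc n) rewrite ℕtoℚ-suc n = ℚP.+-mono-≤ 0≤1 (ℕtoℚ-nonNeg n)

ℕtoℚ-pos : ∀ n → 0ℚ < ℕtoℚ (suc n)
ℕtoℚ-pos n rewrite ℕtoℚ-suc n = ℚP.+-mono-<-≤ (ℚP.positive⁻¹ 1ℚ) (ℕtoℚ-nonNeg n)

ℕtoℚ-mono : ∀ {m n} → m ℕ.≤ n → ℕtoℚ m ≤ ℕtoℚ n
ℕtoℚ-mono {n = n} z≤n = ℕtoℚ-nonNeg n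
ℕtoℚ-mono {suc m} {suc n} (s≤s m≤n) rewrite ℕtoℚ-suc m | ℕtoℚ-suc n =
  ℚP.+-monoʳ-≤ 1ℚ (ℕtoℚ-mono m≤n)

p≤p+q : ∀ {p q} → 0ℚ ≤ q → p ≤ p + q
p≤p+q {p} {q} 0≤q = ℚP.≤-trans (ℚP.≤-reflexive (≡.sym (ℚP.+-identityʳ p))) (ℚP.+-monoʳ-≤ p 0≤q)

q≤p+q : ∀ {p q} → 0ℚ ≤ p → q ≤ p + q
q≤p+q {p} {q} 0≤p = ℚP.≤-trans (ℚP.≤-reflexive (≡.sym (ℚP.+-identityˡ q))) (ℚP.+-monoˡ-≤ q 0≤p)

0≤q-p : ∀ {p q} → p ≤ q → 0ℚ ≤ q - p
0≤q-p {p} {q} p≤q = ≡.subst (_≤ q - p) (ℚP.+-inverseʳ p) (ℚP.+-monoˡ-≤ (- p) p≤q)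

q-p≤q : ∀ {p q} → 0ℚ ≤ p → q - p ≤ q
q-p≤q {p} {q} 0≤p =
  ≡.subst (q - p ≤_) (ℚP.+-identityʳ q) (ℚP.+-monoʳ-≤ q (ℚP.neg-antimono-≤ 0≤p))

sideWeight : Side → ℚ → ℚ
sideWeight inside  q = q
sideWeight outside q = 0ℚ

sideWeight-nonNeg : ∀ s {q} → 0ℚ ≤ q → 0ℚ ≤ sideWeight s q
sideWeight-nonNeg inside  0≤q = 0≤q
sideWeight-nonNeg outside 0≤q = ℚP.≤-refl

sumℚ : ∀ {n} → (Fin n → ℚ) → ℚ
sumℚ {zero}  f = 0ℚ
sumℚ {suc n} f = f zero + sumℚ (f ∘ suc)

sumℚ-cong : ∀ {n} {f g : Fin n → ℚ} → (∀ v → f v ≡ g v) → sumℚ f ≡ sumℚ g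
sumℚ-cong {zero}  f≡g = refl
sumℚ-cong {suc n} f≡g = ≡.cong₂ _+_ (f≡g zero) (sumℚ-cong (f≡g ∘ suc))

sumℚ-+ : ∀ {n} (f g : Fin n → ℚ) → sumℚ (λ v → f v + g v) ≡ sumℚ f + sumℚ g
sumℚ-+ {zero}  f g = ≡.sym (ℚP.+-identityˡ 0ℚ)
sumℚ-+ {suc n} f g rewrite sumℚ-+ (f ∘ suc) (g ∘ suc) =
  solve 4 (λ a b c d → (a :+ b) :+ (c :+ d) := (a :+ c) :+ (b :+ d)) refl
    (f zero) (g zero) (sumℚ (f ∘ suc)) (sumℚ (g ∘ suc))

sumℚ-mono : ∀ {n} {f g : Fin n → ℚ} → (∀ v → f v ≤ g v) → sumℚ f ≤ sumℚ g
sumℚ-mono {zero}  f≤g = ℚP.≤-refl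
sumℚ-mono {suc n} f≤g = ℚP.+-mono-≤ (f≤g zero) (sumℚ-mono (f≤g ∘ suc))

sumℚ-nonNeg : ∀ {n} {f : Fin n → ℚ} → (∀ v → 0ℚ ≤ f v) → 0ℚ ≤ sumℚ f
sumℚ-nonNeg {zero}  0≤f = ℚP.≤-refl
sumℚ-nonNeg {suc n} 0≤f = ℚP.+-mono-≤ (0≤f zero) (sumℚ-nonNeg (0≤f ∘ suc))

sumℚ-zero : ∀ n → sumℚ {n} (λ _ → 0ℚ) ≡ 0ℚ
sumℚ-zero zero    = refl
sumℚ-zero (suc n) = cong (0ℚ +_) (sumℚ-zero n)

term≤sumℚ : ∀ {n} (f : Fin n → ℚ) → (∀ u → 0ℚ ≤ f u) → ∀ v → f v ≤ sumℚ f
term≤sumℚ f 0≤f zero    = p≤p+q (sumℚ-nonNeg (0≤f ∘ suc))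
term≤sumℚ f 0≤f (suc v) = ℚP.≤-trans (term≤sumℚ (f ∘ suc) (0≤f ∘ suc) v) (q≤p+q (0≤f zero))

sumℚ-sideWeight : ∀ {n} (S : Subset n) q → sumℚ (λ v → sideWeight (lookup S v) q) ≡ q * ℕtoℚ ∣ S ∣
sumℚ-sideWeight []            q = ≡.sym (ℚP.*-zeroʳ q)
sumℚ-sideWeight (inside ∷ S)  q rewrite sumℚ-sideWeight S q | ℕtoℚ-suc ∣ S ∣ =
  solve 2 (λ q s → q :+ q :* s := q :* (con 1ℚ :+ s)) refl q (ℕtoℚ ∣ S ∣)
sumℚ-sideWeight (outside ∷ S) q rewrite sumℚ-sideWeight S q = ℚP.+-identityˡ _

module _ {n : ℕ} (G : Graph n) where

  weightAt-∷ : ∀ v S q F → weightAt G v ((S , q) ∷ F) ≡ sideWeight (lookup S v) q + weightAt G v F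
  weightAt-∷ v S q F with lookup S v
  ... | inside  = refl
  ... | outside = ≡.sym (ℚP.+-identityˡ _)

  weightAt-++ : ∀ v A B → weightAt G v (A ++ B) ≡ weightAt G v A + weightAt G v B
  weightAt-++ v [] B = ≡.sym (ℚP.+-identityˡ _)
  weightAt-++ v ((S , q) ∷ A) B
    rewrite weightAt-∷ v S q (A ++ B) | weightAt-∷ v S q A | weightAt-++ v A B =
    ≡.sym (ℚP.+-assoc (sideWeight (lookup S v) q) _ _)

  totalWeight-++ : ∀ A B → totalWeight G (A ++ B) ≡ totalWeight G A + totalWeight G B
  totalWeight-++ [] B = ≡.sym (ℚP.+-identityˡ _)
  totalWeight-++ ((S , q) ∷ A) B rewrite totalWeight-++ A B = ≡.sym (ℚP.+-assoc q _ _)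

  weightAt-nonNeg : ∀ v F → NonNeg G F → 0ℚ ≤ weightAt G v F
  weightAt-nonNeg v [] [] = ℚP.≤-refl
  weightAt-nonNeg v ((S , q) ∷ F) (0≤q ∷ 0≤F) rewrite weightAt-∷ v S q F =
    ℚP.+-mono-≤ (sideWeight-nonNeg (lookup S v) 0≤q) (weightAt-nonNeg v F 0≤F)

  totalWeight-nonNeg : ∀ F → NonNeg G F → 0ℚ ≤ totalWeight G F
  totalWeight-nonNeg [] [] = ℚP.≤-refl
  totalWeight-nonNeg ((S , q) ∷ F) (0≤q ∷ 0≤F) = ℚP.+-mono-≤ 0≤q (totalWeight-nonNeg F 0≤F)

  sizeBound : ∀ w F → All (λ p → ∣ proj₁ p ∣ ℕ.≤ w) F → NonNeg G F →
    sumℚ (λ v → weightAt G v F) ≤ ℕtoℚ w * totalWeight G F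
  sizeBound w [] [] [] = ℚP.≤-reflexive (trans (sumℚ-zero n) (≡.sym (ℚP.*-zeroʳ (ℕtoℚ w))))
  sizeBound w ((S , q) ∷ F) (∣S∣≤w ∷ small) (0≤q ∷ 0≤F) = begin
    sumℚ (λ v → weightAt G v ((S , q) ∷ F))
      ≡⟨ sumℚ-cong (λ v → weightAt-∷ v S q F) ⟩
    sumℚ (λ v → sideWeight (lookup S v) q + weightAt G v F)
      ≡⟨ sumℚ-+ (λ v → sideWeight (lookup S v) q) (λ v → weightAt G v F) ⟩
    sumℚ (λ v → sideWeight (lookup S v) q) + sumℚ (λ v → weightAt G v F)
      ≡⟨ cong (_+ sumℚ (λ v → weightAt G v F)) (sumℚ-sideWeight S q) ⟩
    q * ℕtoℚ ∣ S ∣ + sumℚ (λ v → weightAt G v F)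
      ≤⟨ ℚP.+-mono-≤ (ℚP.*-monoˡ-≤-nonNeg q {{nonNegative 0≤q}} (ℕtoℚ-mono ∣S∣≤w))
                     (sizeBound w F small 0≤F) ⟩
    q * ℕtoℚ w + ℕtoℚ w * totalWeight G F
      ≡⟨ solve 3 (λ q w t → q :* w :+ w :* t := w :* (q :+ t)) refl q (ℕtoℚ w) (totalWeight G F) ⟩
    ℕtoℚ w * (q + totalWeight G F) ∎

  indexedFamily : ∀ {m} → (Fin m → Subset n) → (Fin m → ℚ) → WeightedFamily G
  indexedFamily S f = tabulate (λ i → S i , f i)

  totalWeight-indexed : ∀ {m} (S : Fin m → Subset n) f → totalWeight G (indexedFamily S f) ≡ sumℚ f
  totalWeight-indexed {zero}  S f = refl
  totalWeight-indexed {suc m} S f = cong (f zero +_) (totalWeight-indexed (S ∘ suc) (f ∘ suc))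

  weightAt-indexed : ∀ {m} (S : Fin m → Subset n) f v →
    weightAt G v (indexedFamily S f) ≡ sumℚ (λ i → sideWeight (lookup (S i) v) (f i))
  weightAt-indexed {zero}  S f v = refl
  weightAt-indexed {suc m} S f v =
    trans (weightAt-∷ v (S zero) (f zero) _)
          (cong (sideWeight (lookup (S zero) v) (f zero) +_) (weightAt-indexed (S ∘ suc) (f ∘ suc) v))

Demand : ∀ {n} → (Fin n → ℚ) → Set
Demand d = ∀ v → 0ℚ ≤ d v × d v ≤ 1ℚ

positivity : ℚ → Side
positivity q with 0ℚ ℚP.<? q
... | yes _ = inside
... | no  _ = outside

supp : ∀ {n} → (Fin n → ℚ) → Subset n
supp d = Vec.tabulate (positivity ∘ d)

∈-supp⁺ : ∀ {n} {d : Fin n → ℚ} {v} → 0ℚ < d v → v ∈ supp d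
∈-supp⁺ {d = d} {v} 0<dv =
  VecP.lookup⇒[]= v (supp d) (trans (VecP.lookup∘tabulate (positivity ∘ d) v) inside-if-pos)
  where
  inside-if-pos : positivity (d v) ≡ inside
  inside-if-pos with 0ℚ ℚP.<? d v
  ... | yes _    = refl
  ... | no  0≮dv = ⊥-elim (0≮dv 0<dv)

∈-supp⁻ : ∀ {n} {d : Fin n → ℚ} {v} → v ∈ supp d → 0ℚ < d v
∈-supp⁻ {d = d} {v} v∈supp =
  pos-if-inside (trans (≡.sym (VecP.lookup∘tabulate (positivity ∘ d) v)) (VecP.[]=⇒lookup v∈supp))
  where
  pos-if-inside : positivity (d v) ≡ inside → 0ℚ < d v
  pos-if-inside with 0ℚ ℚP.<? d v
  ... | yes 0<dv = λ _ → 0<dv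
  ... | no  _    = λ ()

sumℚ≤∣supp∣ : ∀ {n} {d : Fin n → ℚ} → Demand d → sumℚ d ≤ ℕtoℚ ∣ supp d ∣
sumℚ≤∣supp∣ {d = d} demand = begin
  sumℚ d                                          ≤⟨ sumℚ-mono below-indicator ⟩
  sumℚ (λ v → sideWeight (lookup (supp d) v) 1ℚ) ≡⟨ sumℚ-sideWeight (supp d) 1ℚ ⟩
  1ℚ * ℕtoℚ ∣ supp d ∣                            ≡⟨ ℚP.*-identityˡ _ ⟩
  ℕtoℚ ∣ supp d ∣                                 ∎
  where
  below-indicator : ∀ v → d v ≤ sideWeight (lookup (supp d) v) 1ℚ
  below-indicator v rewrite VecP.lookup∘tabulate (positivity ∘ d) v with 0ℚ ℚP.<? d v
  ... | yes _    = proj₂ (demand v)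
  ... | no  0≮dv = ℚP.≮⇒≥ 0≮dv

minimumOn : ∀ {n} (f : Fin n → ℚ) (T : Subset n) →
  Empty T ⊎ Σ (Fin n) (λ v₀ → v₀ ∈ T × (∀ {v} → v ∈ T → f v₀ ≤ f v))
minimumOn f [] = inj₁ λ { (_ , ()) }
minimumOn f (outside ∷ T) with minimumOn (f ∘ suc) T
... | inj₁ empty = inj₁ λ { (zero , ()) ; (suc x , there x∈T) → empty (x , x∈T) }
... | inj₂ (u , u∈T , least) = inj₂ (suc u , there u∈T , λ { (there v∈T) → least v∈T })
minimumOn f (inside ∷ T) with minimumOn (f ∘ suc) T
... | inj₁ empty =
  inj₂ (zero , here , λ { here → ℚP.≤-refl ; (there v∈T) → ⊥-elim (empty (_ , v∈T)) })
... | inj₂ (u , u∈T , least) with ℚP.≤-total (f zero) (f (suc u))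
...   | inj₁ f0≤fu =
  inj₂ (zero , here , λ { here → ℚP.≤-refl ; (there v∈T) → ℚP.≤-trans f0≤fu (least v∈T) })
...   | inj₂ fu≤f0 = inj₂ (suc u , there u∈T , λ { here → fu≤f0 ; (there v∈T) → least v∈T })

size⇒nonempty : ∀ {n} (T : Subset n) → 0 ℕ.< ∣ T ∣ → Nonempty T
size⇒nonempty (inside ∷ T)  _   = zero , here
size⇒nonempty (outside ∷ T) pos with size⇒nonempty T pos
... | x , x∈T = suc x , there x∈T

record Peeling {n} (d : Fin n → ℚ) (T : Subset n) : Set where
  field
    amount          : ℚ
    amount-nonNeg   : 0ℚ ≤ amount
    rest            : Fin n → ℚ
    rest-demand     : Demand rest
    decomposition   : ∀ v → d v ≡ sideWeight (lookup T v) amount + rest v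
    support-shrinks : ∣ supp rest ∣ ℕ.< ∣ supp d ∣

  mass : sumℚ d ≡ amount * ℕtoℚ ∣ T ∣ + sumℚ rest
  mass = trans (sumℚ-cong decomposition)
        (trans (sumℚ-+ (λ v → sideWeight (lookup T v) amount) rest)
               (cong (_+ sumℚ rest) (sumℚ-sideWeight T amount)))

-- Any nonempty T inside the support can be peeled off by the minimum ε of d on
-- T: the rest stays nonnegative, and the minimiser leaves the support.
peel : ∀ {n} {d : Fin n → ℚ} {T} → Demand d → T ⊆ supp d → Nonempty T → Peeling d T
peel {n} {d} {T} demand T⊆supp nonempty with minimumOn d T
... | inj₁ empty = ⊥-elim (empty nonempty)
... | inj₂ (v₀ , v₀∈T , least) = record
  { amount          = ε
  ; amount-nonNeg   = proj₁ (demand v₀)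
  ; rest            = rest
  ; rest-demand     = λ v → 0≤q-p (lowering≤d v) , ℚP.≤-trans (rest≤d v) (proj₂ (demand v))
  ; decomposition   = λ v → solve 2 (λ a b → a := b :+ (a :- b)) refl (d v) (sideWeight (lookup T v) ε)
  ; support-shrinks = p⊂q⇒∣p∣<∣q∣ ((λ {v} → supp-rest⊆supp-d v) , v₀ , T⊆supp v₀∈T , v₀∉supp-rest)
  }
  where
  ε : ℚ
  ε = d v₀

  rest : Fin n → ℚ
  rest v = d v - sideWeight (lookup T v) ε

  lowering≤d : ∀ v → sideWeight (lookup T v) ε ≤ d v
  lowering≤d v with lookup T v in v-side
  ... | inside  = least (VecP.lookup⇒[]= v T v-side)
  ... | outside = proj₁ (demand v)

  rest≤d : ∀ v → rest v ≤ d v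
  rest≤d v = q-p≤q (sideWeight-nonNeg (lookup T v) (proj₁ (demand v₀)))

  supp-rest⊆supp-d : ∀ v → v ∈ supp rest → v ∈ supp d
  supp-rest⊆supp-d v v∈ = ∈-supp⁺ (ℚP.<-≤-trans (∈-supp⁻ v∈) (rest≤d v))

  rest-v₀ : rest v₀ ≡ 0ℚ
  rest-v₀ rewrite VecP.[]=⇒lookup v₀∈T = ℚP.+-inverseʳ ε

  v₀∉supp-rest : v₀ ∈ supp rest → ⊥
  v₀∉supp-rest v₀∈ = ℚP.<-irrefl (≡.sym rest-v₀) (∈-supp⁻ v₀∈)

-- Ramsey's property persists when a vertex is added: apply it to the graph
-- without vertex 0.
ramsey-suc : ∀ {k N} → RamseyProperty k N → RamseyProperty k (suc N)
ramsey-suc {k} {N} ramsey H with ramsey H₀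
  where
  H₀ : Graph N
  H₀ = record { Adj = λ i j → Adj H (suc i) (suc j) ; sym = sym H ; irrefl = irrefl H }
... | S , inj₁ clique , ∣S∣≡k = outside ∷ S , inj₁ clique′ , ∣S∣≡k
  where
  clique′ : IsClique H (outside ∷ S)
  clique′ (suc u) (suc v) (there u∈S) (there v∈S) u≢v = clique u v u∈S v∈S (u≢v ∘ cong suc)
... | S , inj₂ indep , ∣S∣≡k = outside ∷ S , inj₂ indep′ , ∣S∣≡k
  where
  indep′ : IsIndependent H (outside ∷ S)
  indep′ (suc u) (suc v) (there u∈S) (there v∈S) = indep u v u∈S v∈S

ramsey-mono : ∀ {k N M} → RamseyProperty k N → N ℕ.≤ M → RamseyProperty k M
ramsey-mono {k} {N} ramsey N≤M = go (ℕP.≤⇒≤′ N≤M)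
  where
  go : ∀ {M} → N ℕ.≤′ M → RamseyProperty k M
  go ℕ.≤′-refl     = ramsey
  go (ℕ.≤′-step h) = ramsey-suc (go h)

element : ∀ {n} (U : Subset n) → Fin ∣ U ∣ → Fin n
element (inside ∷ U)  zero    = zero
element (inside ∷ U)  (suc i) = suc (element U i)
element (outside ∷ U) i       = suc (element U i)

induced : ∀ {n} → Graph n → (U : Subset n) → Graph ∣ U ∣
induced G U = record
  { Adj = λ i j → Adj G (element U i) (element U j) ; sym = sym G ; irrefl = irrefl G }

image : ∀ {n} (U : Subset n) → Subset ∣ U ∣ → Subset n
image []            []      = []
image (inside ∷ U)  (s ∷ T) = s ∷ image U T
image (outside ∷ U) T       = outside ∷ image U T

image-⊆ : ∀ {n} (U : Subset n) T → image U T ⊆ U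
image-⊆ (inside ∷ U)  (s ∷ T) here       = here
image-⊆ (inside ∷ U)  (s ∷ T) (there x∈) = there (image-⊆ U T x∈)
image-⊆ (outside ∷ U) T       (there x∈) = there (image-⊆ U T x∈)

∣image∣ : ∀ {n} (U : Subset n) T → ∣ image U T ∣ ≡ ∣ T ∣
∣image∣ []            []            = refl
∣image∣ (inside ∷ U)  (inside ∷ T)  = cong suc (∣image∣ U T)
∣image∣ (inside ∷ U)  (outside ∷ T) = ∣image∣ U T
∣image∣ (outside ∷ U) T             = ∣image∣ U T

∈-image⁻ : ∀ {n} (U : Subset n) T {x} → x ∈ image U T → ∃ λ i → i ∈ T × element U i ≡ x
∈-image⁻ (inside ∷ U)  (s ∷ T) here = zero , here , refl
∈-image⁻ (inside ∷ U)  (s ∷ T) (there x∈) with ∈-image⁻ U T x∈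
... | i , i∈T , refl = suc i , there i∈T , refl
∈-image⁻ (outside ∷ U) T (there x∈) with ∈-image⁻ U T x∈
... | i , i∈T , refl = i , i∈T , refl

module _ {n : ℕ} (G : Graph n) (U : Subset n) where

  image-clique : ∀ {T} → IsClique (induced G U) T → IsClique G (image U T)
  image-clique {T} clique x y x∈ y∈ x≢y with ∈-image⁻ U T x∈ | ∈-image⁻ U T y∈
  ... | i , i∈T , refl | j , j∈T , refl = clique i j i∈T j∈T (x≢y ∘ cong (element U))

  image-independent : ∀ {T} → IsIndependent (induced G U) T → IsIndependent G (image U T)
  image-independent {T} indep x y x∈ y∈ with ∈-image⁻ U T x∈ | ∈-image⁻ U T y∈
  ... | i , i∈T , refl | j , j∈T , refl = indep i j i∈T j∈T

  ramsey-within : ∀ {k N} → RamseyProperty k N → N ℕ.≤ ∣ U ∣ →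
    Σ (Subset n) λ T → T ⊆ U × (IsClique G T ⊎ IsIndependent G T) × ∣ T ∣ ≡ k
  ramsey-within ramsey N≤∣U∣ with ramsey-mono ramsey N≤∣U∣ (induced G U)
  ... | S , inj₁ clique , ∣S∣≡k =
    image U S , image-⊆ U S , inj₁ (image-clique clique) , trans (∣image∣ U S) ∣S∣≡k
  ... | S , inj₂ indep  , ∣S∣≡k =
    image U S , image-⊆ U S , inj₂ (image-independent indep) , trans (∣image∣ U S) ∣S∣≡k

module _ {n : ℕ} (G : Graph n) where

  IndependentCover : (Fin n → ℚ) → WeightedFamily G → Set
  IndependentCover d H =
    All (λ p → IsIndependent G (proj₁ p)) H × NonNeg G H × (∀ v → d v ≤ weightAt G v H)

  singleton-independent : ∀ v → IsIndependent G ⁅ v ⁆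
  singleton-independent v x y x∈ y∈ with x∈⁅y⁆⇒x≡y v x∈ | x∈⁅y⁆⇒x≡y v y∈
  ... | refl | refl = irrefl G

  singletonCover : ∀ d → (∀ v → 0ℚ ≤ d v) → IndependentCover d (indexedFamily G ⁅_⁆ d)
  singletonCover d 0≤d = tabulate⁺ singleton-independent , tabulate⁺ 0≤d , covers
    where
    covers : ∀ v → d v ≤ weightAt G v (indexedFamily G ⁅_⁆ d)
    covers v = begin
      d v
        ≡⟨ cong (λ s → sideWeight s (d v)) (≡.sym (VecP.[]=⇒lookup (x∈⁅x⁆ v))) ⟩
      sideWeight (lookup ⁅ v ⁆ v) (d v)
        ≤⟨ term≤sumℚ _ (λ u → sideWeight-nonNeg (lookup ⁅ u ⁆ v) (0≤d u)) v ⟩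
      sumℚ (λ u → sideWeight (lookup ⁅ u ⁆ v) (d u))
        ≡⟨ ≡.sym (weightAt-indexed G ⁅_⁆ d v) ⟩
      weightAt G v (indexedFamily G ⁅_⁆ d)
        ∎

module GreedyCover {n : ℕ} (G : Graph n) (w R : ℕ)
    (cliqueBound : ∀ S → IsClique G S → ∣ S ∣ ℕ.≤ w)
    (ramsey : RamseyProperty (suc w) R) where

  -- the size of the independent sets supplied by Ramsey's property
  K : ℚ
  K = ℕtoℚ (suc w)

  independentWithin : ∀ U → R ℕ.≤ ∣ U ∣ →
    Σ (Subset n) λ T → T ⊆ U × IsIndependent G T × ∣ T ∣ ≡ suc w
  independentWithin U R≤∣U∣ with ramsey-within G U ramsey R≤∣U∣
  ... | T , T⊆U , inj₂ indep  , ∣T∣≡K = T , T⊆U , indep , ∣T∣≡K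
  ... | T , T⊆U , inj₁ clique , ∣T∣≡K =
    ⊥-elim (ℕP.<-irrefl refl (≡.subst (ℕ._≤ w) ∣T∣≡K (cliqueBound T clique)))

  BoundedCover : (Fin n → ℚ) → Set
  BoundedCover d =
    Σ (WeightedFamily G) λ H → IndependentCover G d H × K * totalWeight G H ≤ sumℚ d + K * ℕtoℚ R

  -- Small supports: the singleton cover costs Σ d ≤ ∣ supp d ∣ ≤ R.
  smallCover : ∀ d → Demand d → ∣ supp d ∣ ℕ.≤ R → BoundedCover d
  smallCover d demand ∣supp∣≤R = indexedFamily G ⁅_⁆ d , singletonCover G d (proj₁ ∘ demand) , bound
    where
    bound : K * totalWeight G (indexedFamily G ⁅_⁆ d) ≤ sumℚ d + K * ℕtoℚ R
    bound = begin
      K * totalWeight G (indexedFamily G ⁅_⁆ d) ≡⟨ cong (K *_) (totalWeight-indexed G ⁅_⁆ d) ⟩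
      K * sumℚ d                                ≤⟨ ℚP.*-monoˡ-≤-nonNeg K {{nonNegative (ℕtoℚ-nonNeg (suc w))}}
                                                     (ℚP.≤-trans (sumℚ≤∣supp∣ demand) (ℕtoℚ-mono ∣supp∣≤R)) ⟩
      K * ℕtoℚ R                                ≤⟨ q≤p+q (sumℚ-nonNeg (proj₁ ∘ demand)) ⟩
      sumℚ d + K * ℕtoℚ R                       ∎

  -- Peeling an independent set T of size K by ε costs weight ε and lowers the
  -- total demand by ε·K, so a bounded cover of the rest extends to one of d.
  extendCover : ∀ {d T} (peeling : Peeling d T) → IsIndependent G T → ∣ T ∣ ≡ suc w →
    BoundedCover (Peeling.rest peeling) → BoundedCover d
  extendCover {d} {T} peeling indep ∣T∣≡K (H , (indep-H , 0≤H , covers-H) , bound-H) =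
    (T , ε) ∷ H , (indep ∷ indep-H , amount-nonNeg ∷ 0≤H , covers) , bound
    where
    open Peeling peeling renaming (amount to ε)

    covers : ∀ v → d v ≤ weightAt G v ((T , ε) ∷ H)
    covers v = begin
      d v                                        ≡⟨ decomposition v ⟩
      sideWeight (lookup T v) ε + rest v         ≤⟨ ℚP.+-monoʳ-≤ (sideWeight (lookup T v) ε) (covers-H v) ⟩
      sideWeight (lookup T v) ε + weightAt G v H ≡⟨ ≡.sym (weightAt-∷ G v T ε H) ⟩
      weightAt G v ((T , ε) ∷ H)                 ∎

    bound : K * (ε + totalWeight G H) ≤ sumℚ d + K * ℕtoℚ R
    bound = begin
      K * (ε + totalWeight G H)                 ≡⟨ ℚP.*-distribˡ-+ K ε (totalWeight G H) ⟩
      K * ε + K * totalWeight G H               ≤⟨ ℚP.+-monoʳ-≤ (K * ε) bound-H ⟩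
      K * ε + (sumℚ rest + K * ℕtoℚ R)          ≡⟨ solve 4 (λ k e s r → k :* e :+ (s :+ r) := (e :* k :+ s) :+ r)
                                                         refl K ε (sumℚ rest) (K * ℕtoℚ R) ⟩
      (ε * K + sumℚ rest) + K * ℕtoℚ R          ≡⟨ cong (λ t → ε * ℕtoℚ t + sumℚ rest + K * ℕtoℚ R)
                                                         (≡.sym ∣T∣≡K) ⟩
      (ε * ℕtoℚ ∣ T ∣ + sumℚ rest) + K * ℕtoℚ R ≡⟨ cong (_+ K * ℕtoℚ R) (≡.sym mass) ⟩
      sumℚ d + K * ℕtoℚ R                       ∎

  greedyCover : ∀ d → Demand d → Acc ℕ._<_ ∣ supp d ∣ → BoundedCover d
  greedyCover d demand (acc smaller) with ∣ supp d ∣ ℕ.<? R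
  ... | yes small = smallCover d demand (ℕP.<⇒≤ small)
  ... | no large with independentWithin (supp d) (ℕP.≮⇒≥ large)
  ...   | T , T⊆supp , indep , ∣T∣≡K =
    extendCover peeling indep ∣T∣≡K (greedyCover rest rest-demand (smaller support-shrinks))
    where
    peeling : Peeling d T
    peeling = peel demand T⊆supp (size⇒nonempty T (≡.subst (0 ℕ.<_) (≡.sym ∣T∣≡K) ℕ.z<s))
    open Peeling peeling

module _ {n : ℕ} (G : Graph n) {P Q : Subset n × ℚ → Set} where

  leftPart rightPart : (F : WeightedFamily G) → All (λ p → P p ⊎ Q p) F → WeightedFamily G
  leftPart  []      []            = []
  leftPart  (p ∷ F) (inj₁ _ ∷ PQ) = p ∷ leftPart F PQ
  leftPart  (p ∷ F) (inj₂ _ ∷ PQ) = leftPart F PQ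
  rightPart []      []            = []
  rightPart (p ∷ F) (inj₁ _ ∷ PQ) = rightPart F PQ
  rightPart (p ∷ F) (inj₂ _ ∷ PQ) = p ∷ rightPart F PQ

  leftPart-all : ∀ {S : Subset n × ℚ → Set} F PQ → All S F → All (λ p → P p × S p) (leftPart F PQ)
  leftPart-all []      []             []       = []
  leftPart-all (p ∷ F) (inj₁ Pp ∷ PQ) (Sp ∷ SF) = (Pp , Sp) ∷ leftPart-all F PQ SF
  leftPart-all (p ∷ F) (inj₂ _  ∷ PQ) (_  ∷ SF) = leftPart-all F PQ SF

  rightPart-all : ∀ {S : Subset n × ℚ → Set} F PQ → All S F → All (λ p → Q p × S p) (rightPart F PQ)
  rightPart-all []      []             []       = []
  rightPart-all (p ∷ F) (inj₁ _  ∷ PQ) (_  ∷ SF) = rightPart-all F PQ SF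
  rightPart-all (p ∷ F) (inj₂ Qp ∷ PQ) (Sp ∷ SF) = (Qp , Sp) ∷ rightPart-all F PQ SF

  weightAt-parts : ∀ v F PQ → weightAt G v F ≡ weightAt G v (leftPart F PQ) + weightAt G v (rightPart F PQ)
  weightAt-parts v [] [] = ≡.sym (ℚP.+-identityˡ 0ℚ)
  weightAt-parts v ((S , q) ∷ F) (inj₁ _ ∷ PQ)
    rewrite weightAt-∷ G v S q F | weightAt-∷ G v S q (leftPart F PQ) | weightAt-parts v F PQ =
    ≡.sym (ℚP.+-assoc (sideWeight (lookup S v) q) _ _)
  weightAt-parts v ((S , q) ∷ F) (inj₂ _ ∷ PQ)
    rewrite weightAt-∷ G v S q F | weightAt-∷ G v S q (rightPart F PQ) | weightAt-parts v F PQ =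
    solve 3 (λ s a b → s :+ (a :+ b) := a :+ (s :+ b)) refl
      (sideWeight (lookup S v) q) (weightAt G v (leftPart F PQ)) (weightAt G v (rightPart F PQ))

  totalWeight-parts : ∀ F PQ → totalWeight G F ≡ totalWeight G (leftPart F PQ) + totalWeight G (rightPart F PQ)
  totalWeight-parts [] [] = ≡.sym (ℚP.+-identityˡ 0ℚ)
  totalWeight-parts ((S , q) ∷ F) (inj₁ _ ∷ PQ) rewrite totalWeight-parts F PQ =
    ≡.sym (ℚP.+-assoc q _ _)
  totalWeight-parts ((S , q) ∷ F) (inj₂ _ ∷ PQ) rewrite totalWeight-parts F PQ =
    solve 3 (λ s a b → s :+ (a :+ b) := a :+ (s :+ b)) refl
      q (totalWeight G (leftPart F PQ)) (totalWeight G (rightPart F PQ))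

clip-covers : ∀ {a b} → 0ℚ ≤ a → 1ℚ ≤ b + a → 1ℚ ≤ (1ℚ ⊓ b) + a
clip-covers {a} {b} 0≤a 1≤b+a with ℚP.≤-total 1ℚ b
... | inj₁ 1≤b rewrite ℚP.p≤q⇒p⊓q≡p 1≤b = p≤p+q 0≤a
... | inj₂ b≤1 rewrite ℚP.p≥q⇒p⊓q≡q b≤1 = 1≤b+a

cancel-bound : ∀ w {h s c r} → ℕtoℚ (suc w) * h ≤ s + ℕtoℚ (suc w) * r → s ≤ ℕtoℚ w * c → 0ℚ ≤ c →
  h ≤ c + r
cancel-bound w {h} {s} {c} {r} Kh≤s+Kr s≤wc 0≤c =
  ℚP.*-cancelˡ-≤-pos K {{positive (ℕtoℚ-pos w)}} (begin
    K * h         ≤⟨ Kh≤s+Kr ⟩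
    s + K * r     ≤⟨ ℚP.+-monoˡ-≤ (K * r) (ℚP.≤-trans s≤wc
                       (ℚP.*-monoʳ-≤-nonNeg c {{nonNegative 0≤c}} (ℕtoℚ-mono (ℕP.n≤1+n w)))) ⟩
    K * c + K * r ≡⟨ ≡.sym (ℚP.*-distribˡ-+ K c r) ⟩
    K * (c + r)   ∎)
  where
  K : ℚ
  K = ℕtoℚ (suc w)

completeColoring : ∀ {n} (G : Graph n) d H Fi → IndependentCover G d H →
  All (λ p → IsIndependent G (proj₁ p)) Fi → NonNeg G Fi → (∀ v → 1ℚ ≤ d v + weightAt G v Fi) →
  IsFractionalColoring G (H ++ Fi)
completeColoring G d H Fi (indep-H , 0≤H , covers-H) indep-Fi 0≤Fi deficit =
  ++⁺ indep-H indep-Fi , ++⁺ 0≤H 0≤Fi , covers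
  where
  covers : ∀ v → 1ℚ ≤ weightAt G v (H ++ Fi)
  covers v = begin
    1ℚ                                  ≤⟨ deficit v ⟩
    d v + weightAt G v Fi               ≤⟨ ℚP.+-monoˡ-≤ (weightAt G v Fi) (covers-H v) ⟩
    weightAt G v H + weightAt G v Fi    ≡⟨ ≡.sym (weightAt-++ G v H Fi) ⟩
    weightAt G v (H ++ Fi)              ∎

theorem6 : ∀ {n} (G : Graph n) (w R : ℕ) (x z : ℚ) →
    IsCliqueNumber G w → IsDiagRamseyNumber (suc w) R →
    IsFracChromaticNumber G x → IsFracCochromaticNumber G z →
    x ≤ z + ℕtoℚ R
theorem6 {n} G w R x z (_ , cliqueBound) (ramsey , _) (_ , χ-least) ((F , (kinds , 0≤F , covers) , F≡z) , _) =
  begin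
    x                                              ≤⟨ χ-least (H ++ Fi) coloring ⟩
    totalWeight G (H ++ Fi)                        ≡⟨ totalWeight-++ G H Fi ⟩
    totalWeight G H + totalWeight G Fi             ≤⟨ ℚP.+-monoˡ-≤ (totalWeight G Fi) |H|≤|Fc|+R ⟩
    (totalWeight G Fc + ℕtoℚ R) + totalWeight G Fi ≡⟨ regroup (totalWeight G Fc) (ℕtoℚ R) (totalWeight G Fi) ⟩
    (totalWeight G Fc + totalWeight G Fi) + ℕtoℚ R ≡⟨ cong (_+ ℕtoℚ R) |F|≡z ⟩
    z + ℕtoℚ R                                     ∎
  where
  Fc Fi : WeightedFamily G
  Fc = leftPart G F kinds
  Fi = rightPart G F kinds

  cliques-Fc : All (λ p → IsClique G (proj₁ p) × 0ℚ ≤ proj₂ p) Fc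
  cliques-Fc = leftPart-all G F kinds 0≤F

  indep-Fi : All (λ p → IsIndependent G (proj₁ p)) Fi
  indep-Fi = All.map proj₁ (rightPart-all G F kinds 0≤F)

  0≤Fi : NonNeg G Fi
  0≤Fi = All.map proj₂ (rightPart-all G F kinds 0≤F)

  0≤Fc : NonNeg G Fc
  0≤Fc = All.map proj₂ cliques-Fc

  -- the demand left for independent sets after Fi: what Fc covers, clipped at 1
  d : Fin n → ℚ
  d v = 1ℚ ⊓ weightAt G v Fc

  demand : Demand d
  demand v = ℚP.⊓-glb 0≤1 (weightAt-nonNeg G v Fc 0≤Fc) , ℚP.p⊓q≤p 1ℚ (weightAt G v Fc)

  deficit : ∀ v → 1ℚ ≤ d v + weightAt G v Fi
  deficit v = clip-covers {b = weightAt G v Fc} (weightAt-nonNeg G v Fi 0≤Fi)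
                          (≡.subst (1ℚ ≤_) (weightAt-parts G v F kinds) (covers v))

  -- every clique has at most w vertices, so Fc covers at most w·|Fc| in total
  Σd≤w·Fc : sumℚ d ≤ ℕtoℚ w * totalWeight G Fc
  Σd≤w·Fc = ℚP.≤-trans (sumℚ-mono (λ v → ℚP.p⊓q≤q 1ℚ (weightAt G v Fc)))
                       (sizeBound G w Fc (All.map (λ p → cliqueBound _ (proj₁ p)) cliques-Fc) 0≤Fc)

  open GreedyCover G w R cliqueBound ramsey using (BoundedCover; greedyCover)

  greedy : BoundedCover d
  greedy = greedyCover d demand (<-wellFounded ∣ supp d ∣)

  H : WeightedFamily G
  H = proj₁ greedy

  cover-H : IndependentCover G d H
  cover-H = proj₁ (proj₂ greedy)

  bound-H : ℕtoℚ (suc w) * totalWeight G H ≤ sumℚ d + ℕtoℚ (suc w) * ℕtoℚ R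
  bound-H = proj₂ (proj₂ greedy)

  coloring : IsFractionalColoring G (H ++ Fi)
  coloring = completeColoring G d H Fi cover-H indep-Fi 0≤Fi deficit

  |H|≤|Fc|+R : totalWeight G H ≤ totalWeight G Fc + ℕtoℚ R
  |H|≤|Fc|+R = cancel-bound w bound-H Σd≤w·Fc (totalWeight-nonNeg G Fc 0≤Fc)

  |F|≡z : totalWeight G Fc + totalWeight G Fi ≡ z
  |F|≡z = trans (≡.sym (totalWeight-parts G F kinds)) F≡z

  regroup : ∀ c r i → (c + r) + i ≡ (c + i) + r
  regroup = solve 3 (λ c r i → (c :+ r) :+ i := (c :+ i) :+ r) refl
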